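{- There is a function $g$ such that for all integers $k,m\ge1$, Presenter has a finite strategy in the game $\mathrm{ABS}(k)$ that forces Algorithm to use at least $2m^{k-1}-1$ colors within at most $2^{g(k)m}$ rounds, and the number of presentation scenarios that can occur with this strategy, over all possible responses of Algorithm, is at most $2^{2^{g(k)m}}$.
   Context: The on-line game $\mathrm{ABS}(k)$: Presenter presents vertices one at a time (presentation order $\prec$); with each new vertex $v$ Presenter declares for each earlier $u$ exactly one of $u\sqsupset v$, $u\between v$, $u\parallel v$ (so these relations partition $\prec$), such that for all $x,y,z$: (A1) $x\sqsupset y$, $y\sqsupset z$ imply $x\sqsupset z$; (A2) $x\sqsupset y$, $y\between z$ imply $x\sqsupset z$ or $x\between z$; (A3) $x\between y$, $y\sqsupset z$ imply $x\between z$ or $x\parallel z$; (A4) $x\parallel y$, $y\prec z$ imply $x\parallel z$. The presented graph $G$ has $xy\in E(G)$ iff $x\between y$ or $y\between x$, and Presenter must keep $\omega(G)\le k$. Algorithm colors each vertex immediately and irrevocably, keeping the coloring proper. A presentation scenario is the structure (graph, relations, order) presented after some round; a Presenter strategy is finite if the total number of presentation scenarios that can occur when following it, over all responses of Algorithm, is finite. -}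

module Defs where

open import Data.Nat using (ℕ; zero; suc; _<_; _≤_; _≟_; _*_; _^_; _∸_)
open import Data.Fin using (Fin; toℕ)
open import Data.Vec using (Vec; []; _∷_; _∷ʳ_; lookup)
open import Data.Maybe using (Maybe; just; nothing)
open import Data.Product using (Σ; _×_; _,_; proj₁)
open import Data.Sum using (_⊎_)
open import Data.List using (List; length)
open import Data.List.Membership.Propositional using (_∈_)
open import Relation.Nullary using (¬_; yes; no)
open import Relation.Binary.PropositionalEquality using (_≡_; _≢_)

-- The three relations a new vertex v can have with an earlier vertex u:
--   sq  : u ⊐ v      bt : u ≬ v (between / edge)      pl : u ∥ v
data Lab : Set where
  sq bt pl : Lab

-- A presentation scenario with n vertices 0,…,n-1 (presentation order = index order).
-- Vertex j is added together with a row (Vec Lab j) whose i-th entry is the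
-- relation declared between the earlier vertex i and j.
data Pres : ℕ → Set where
  []  : Pres zero
  _▷_ : ∀ {n} → Pres n → Vec Lab n → Pres (suc n)

vget : ∀ {A : Set} {m} → Vec A m → ℕ → Maybe A
vget []       _       = nothing
vget (x ∷ xs) zero    = just x
vget (x ∷ xs) (suc i) = vget xs i

-- lab? s i j = just ℓ  iff  i ≺ j are vertices of s and the declared relation is ℓ.
lab? : ∀ {n} → Pres n → ℕ → ℕ → Maybe Lab
lab? [] i j = nothing
lab? (_▷_ {n} s r) i j with j ≟ n
... | yes _ = vget r i
... | no  _ = lab? s i j

Rl : ∀ {n} → Pres n → Lab → ℕ → ℕ → Set
Rl s ℓ x y = lab? s x y ≡ just ℓ

Axioms : ∀ {n} → Pres n → Set
Axioms {n} s =
  (∀ x y z → Rl s sq x y → Rl s sq y z → Rl s sq x z) ×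
  (∀ x y z → Rl s sq x y → Rl s bt y z → Rl s sq x z ⊎ Rl s bt x z) ×
  (∀ x y z → Rl s bt x y → Rl s sq y z → Rl s bt x z ⊎ Rl s pl x z) ×
  (∀ x y z → Rl s pl x y → y < z → z < n → Rl s pl x z)

Edge : ∀ {n} → Pres n → ℕ → ℕ → Set
Edge s x y = Rl s bt x y ⊎ Rl s bt y x

CliqueAtMost : ℕ → ∀ {n} → Pres n → Set
CliqueAtMost k s =
  ¬ (Σ (Fin (suc k) → ℕ) λ f → ∀ a b → a ≢ b → Edge s (f a) (f b))

Legal : ℕ → ∀ {n} → Pres n → Set
Legal k s = Axioms s × CliqueAtMost k s

-- Game state after some rounds: scenario together with Algorithm's colors
-- (color of vertex i at position i).
State : Set
State = Σ ℕ λ n → Pres n × Vec ℕ n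

scenario : State → Σ ℕ Pres
scenario (n , s , _) = n , s

-- Deterministic adaptive Presenter: given the history, either stop (nothing)
-- or present a new vertex with its relations to all earlier vertices.
Strategy : Set
Strategy = (n : ℕ) → Pres n → Vec ℕ n → Maybe (Vec Lab n)

Algorithm : Set
Algorithm = (n : ℕ) → Pres (suc n) → Vec ℕ n → ℕ

Proper : Algorithm → Set
Proper A = ∀ n (s : Pres (suc n)) (c : Vec ℕ n) (i : Fin n) →
  Edge s (toℕ i) n → A n s c ≢ lookup c i

step : Strategy → Algorithm → State → State
step S A (n , s , c) with S n s c
... | nothing = n , s , c
... | just r  = suc n , (s ▷ r) , (c ∷ʳ A n (s ▷ r) c)

play : Strategy → Algorithm → ℕ → State
play S A zero    = zero , [] , []
play S A (suc t) = step S A (play S A t)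

UsesAtLeast : ℕ → State → Set
UsesAtLeast N (n , s , c) =
  Σ (Fin N → Fin n) λ f → ∀ a b → lookup c (f a) ≡ lookup c (f b) → a ≡ b

-- Presenter's strategy S in ABS(k) forces at least N colors within R rounds,
-- and at most B presentation scenarios can occur (hence S is finite).
Forces : ℕ → Strategy → ℕ → ℕ → ℕ → Set
Forces k S N R B =
  (∀ (A : Algorithm) → Proper A → ∀ t → Legal k (proj₂′ (scenario (play S A t)))) ×
  (∀ (A : Algorithm) → Proper A → UsesAtLeast N (play S A R)) ×
  (Σ (List (Σ ℕ Pres)) λ L → length L ≤ B ×
     (∀ (A : Algorithm) → Proper A → ∀ t → scenario (play S A (suc t)) ∈ L))
  where
  proj₂′ : (p : Σ ℕ Pres) → Pres (proj₁ p)
  proj₂′ (_ , s) = s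

-- Presenter only presents vertices v that lie ⊐-below a set K of earlier
-- vertices, are adjacent to a set Q and ∥-unrelated to the rest; such a row
-- keeps (A1)–(A4) when (K, Q) is admissible, and keeps ω ≤ k when Q has no
-- k-clique.
--
-- Level j with i+1 stages plays level j with i stages twice, the second copy
-- Y ⊐-below the first copy X; every play is ⊐-below its own earlier vertices,
-- so the vertices of Y form an independent set.  If Y shows h = ⌈γ(j−1)/2⌉
-- colours missing from X, the two copies together gain h colours.  Otherwise Y
-- repeats all but fewer than h colours of X, and a level-(j−1) play W adjacent
-- to all of Y (which raises the clique number of Q by at most one) must avoid
-- the colours of Y, so at least h of its γ(j−1) colours are missing from X.
-- With L = 4m stages per level this forces (2m)^(k−1) ≥ 2m^(k−1) − 1 colours
-- on at most 2^((L+1)(k−1)) vertices.  Presenter reacts only to the colours,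
-- so the scenarios that occur are among the at most 4^(n²) presentations of
-- each size n up to that bound.

module Submission where

open import Defs
open import Data.Bool using (Bool; true; false; _∨_; T; if_then_else_)
open import Data.Bool.Properties using (T-∨; T?; ∨-assoc)
open import Data.Empty using (⊥-elim)
open import Data.Fin using (Fin; zero; suc; toℕ; fromℕ<; punchIn; inject≤)
open import Data.Fin.Properties
  using (any?; punchIn-injective; punchInᵢ≢i; inject≤-injective; injective⇒≤; toℕ-fromℕ<)
  renaming (suc-injective to Fin-suc-injective)
open import Data.List as List using (List; []; _∷_; length; _++_; filter; map; cartesianProductWith)
open import Data.List.Membership.Propositional using (_∈_; _∉_)
open import Data.List.Membership.Propositional.Properties
  using (∈-filter⁻; ∈-filter⁺; ∈-++⁻; ∈-++⁺ˡ; ∈-++⁺ʳ; ∈-map⁺; ∈-lookup; ∈-cartesianProductWith⁺)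
open import Data.List.Membership.Setoid.Properties using (index-injective)
open import Data.List.Properties using (length-++; length-map)
open import Data.List.Relation.Binary.Subset.Propositional using (_⊆_)
import Data.List.Relation.Unary.All as All
open import Data.List.Relation.Unary.AllPairs using ([]; _∷_)
open import Data.List.Relation.Unary.Any as Any using (here; there)
open import Data.List.Relation.Unary.Unique.Propositional using (Unique)
import Data.List.Relation.Unary.Unique.Propositional.Properties as Unique
open import Data.Maybe using (Maybe; just; nothing)
open import Data.Maybe.Properties using (just-injective)
open import Data.Nat
open import Data.Nat.Properties
open import Data.Nat.Solver using (module +-*-Solver)
open import Data.List.Membership.DecPropositional _≟_ using (_∈?_; _∉?_)
open import Data.Product using (Σ; ∃; _×_; _,_; proj₁; proj₂; map₂)
open import Data.Sum as Sum using (_⊎_; inj₁; inj₂; [_,_]′)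
open import Data.Vec using (Vec; []; _∷_; _∷ʳ_; lookup; tabulate; toList)
open import Data.Vec.Properties using (toList-∷ʳ)
open import Function using (_∘_; id; Equivalence)
open import Relation.Binary.PropositionalEquality
  using (_≡_; _≢_; refl; sym; trans; cong; cong₂; subst; setoid; module ≡-Reasoning)
open import Relation.Nullary using (¬_; yes; no; contradiction)
open import Relation.Nullary.Reflects using (ofʸ; ofⁿ)

open +-*-Solver using (solve; _:+_; _:*_; con; _:=_)

-- Rows given by sets of earlier vertices

VSet : Set
VSet = ℕ → Bool

_∈ᵛ_ : ℕ → VSet → Set
x ∈ᵛ A = T (A x)

∅ : VSet
∅ _ = false

｛_｝ : ℕ → VSet
｛ n ｝ x = x ≡ᵇ n

_∪_ : VSet → VSet → VSet
(A ∪ B) x = A x ∨ B x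

∪⁻ : ∀ A B {x} → x ∈ᵛ (A ∪ B) → x ∈ᵛ A ⊎ x ∈ᵛ B
∪⁻ A B {x} = Equivalence.to (T-∨ {A x} {B x})

∪⁺ˡ : ∀ A B {x} → x ∈ᵛ A → x ∈ᵛ (A ∪ B)
∪⁺ˡ A B {x} = Equivalence.from (T-∨ {A x} {B x}) ∘ inj₁

∪⁺ʳ : ∀ A B {x} → x ∈ᵛ B → x ∈ᵛ (A ∪ B)
∪⁺ʳ A B {x} = Equivalence.from (T-∨ {A x} {B x}) ∘ inj₂

∈｛｝⁻ : ∀ {n x} → x ∈ᵛ ｛ n ｝ → x ≡ n
∈｛｝⁻ {n} {x} = ≡ᵇ⇒≡ x n

∈｛｝⁺ : ∀ n → n ∈ᵛ ｛ n ｝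
∈｛｝⁺ n = ≡⇒≡ᵇ n n refl

data LabelView (K Q : VSet) (x : ℕ) : Lab → Set where
  in-K    : x ∈ᵛ K → LabelView K Q x sq
  in-Q    : ¬ x ∈ᵛ K → x ∈ᵛ Q → LabelView K Q x bt
  outside : ¬ x ∈ᵛ K → ¬ x ∈ᵛ Q → LabelView K Q x pl

classify : ∀ K Q x → Σ Lab (LabelView K Q x)
classify K Q x with T? (K x) | T? (Q x)
... | yes k | _     = sq , in-K k
... | no ¬k | yes q = bt , in-Q ¬k q
... | no ¬k | no ¬q = pl , outside ¬k ¬q

LabelView-unique : ∀ {K Q x ℓ ℓ′} → LabelView K Q x ℓ → LabelView K Q x ℓ′ → ℓ ≡ ℓ′
LabelView-unique (in-K _)        (in-K _)        = refl
LabelView-unique (in-K k)        (in-Q ¬k _)     = contradiction k ¬k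
LabelView-unique (in-K k)        (outside ¬k _)  = contradiction k ¬k
LabelView-unique (in-Q ¬k _)     (in-K k)        = contradiction k ¬k
LabelView-unique (in-Q _ _)      (in-Q _ _)      = refl
LabelView-unique (in-Q _ q)      (outside _ ¬q)  = contradiction q ¬q
LabelView-unique (outside ¬k _)  (in-K k)        = contradiction k ¬k
LabelView-unique (outside _ ¬q)  (in-Q _ q)      = contradiction q ¬q
LabelView-unique (outside _ _)   (outside _ _)   = refl

row : (n : ℕ) → VSet → VSet → Vec Lab n
row n K Q = tabulate (λ i → proj₁ (classify K Q (toℕ i)))

_▷⟨_,_⟩ : ∀ {n} → Pres n → VSet → VSet → Pres (suc n)
_▷⟨_,_⟩ {n} s K Q = s ▷ row n K Q

vget-tabulate : ∀ {A : Set} n (f : ℕ → A) {x} → x < n →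
                vget (tabulate {n = n} (f ∘ toℕ)) x ≡ just (f x)
vget-tabulate (suc n) f {zero}  _         = refl
vget-tabulate (suc n) f {suc x} (s≤s x<n) = vget-tabulate n (f ∘ suc) x<n

vget-bound : ∀ {A : Set} {m} (v : Vec A m) x {a} → vget v x ≡ just a → x < m
vget-bound (_ ∷ _) zero    _ = s≤s z≤n
vget-bound (_ ∷ v) (suc x) e = s≤s (vget-bound v x e)

lab?-new : ∀ {n} (s : Pres n) r x → lab? (s ▷ r) x n ≡ vget r x
lab?-new {n} s r x with n ≟ n
... | yes _  = refl
... | no n≢n = contradiction refl n≢n

lab?-old : ∀ {n} (s : Pres n) r x {y} → y ≢ n → lab? (s ▷ r) x y ≡ lab? s x y
lab?-old {n} s r x {y} y≢n with y ≟ n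
... | yes y≡n = contradiction y≡n y≢n
... | no _    = refl

Rl-bound : ∀ {n} (s : Pres n) {ℓ} x y → Rl s ℓ x y → x < y × y < n
Rl-bound []             x y ()
Rl-bound (_▷_ {n} s r) x y e with y ≟ n
... | yes refl = vget-bound r x e , n<1+n n
... | no _     = map₂ m<n⇒m<1+n (Rl-bound s x y e)

module _ {n} (s : Pres n) (K Q : VSet) where

  Rl-▷⁻ : ∀ {ℓ x y} → y ≢ n → Rl (s ▷⟨ K , Q ⟩) ℓ x y → Rl s ℓ x y
  Rl-▷⁻ {x = x} y≢n e = trans (sym (lab?-old s (row n K Q) x y≢n)) e

  Rl-▷⁺ : ∀ {ℓ x y} → y < n → Rl s ℓ x y → Rl (s ▷⟨ K , Q ⟩) ℓ x y
  Rl-▷⁺ {x = x} y<n e = trans (lab?-old s (row n K Q) x (<⇒≢ y<n)) e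

  Rl-new⁺ : ∀ {ℓ x} → x < n → LabelView K Q x ℓ → Rl (s ▷⟨ K , Q ⟩) ℓ x n
  Rl-new⁺ {x = x} x<n v = begin
    lab? (s ▷⟨ K , Q ⟩) x n                ≡⟨ lab?-new s (row n K Q) x ⟩
    vget (row n K Q) x                     ≡⟨ vget-tabulate n (proj₁ ∘ classify K Q) x<n ⟩
    just (proj₁ (classify K Q x))          ≡⟨ cong just (LabelView-unique (proj₂ (classify K Q x)) v) ⟩
    just _                                 ∎
    where open ≡-Reasoning

  Rl-new⁻ : ∀ {ℓ x} → Rl (s ▷⟨ K , Q ⟩) ℓ x n → LabelView K Q x ℓ
  Rl-new⁻ {x = x} e = subst (LabelView K Q x) label≡ℓ (proj₂ (classify K Q x))
    where
    e′ = trans (sym (lab?-new s (row n K Q) x)) e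
    label≡ℓ = just-injective
      (trans (sym (vget-tabulate n (proj₁ ∘ classify K Q) (vget-bound (row n K Q) x e′))) e′)

  Rl-▷-cases : ∀ {ℓ x y} → Rl (s ▷⟨ K , Q ⟩) ℓ x y →
               (y < n × Rl s ℓ x y) ⊎ (y ≡ n × LabelView K Q x ℓ)
  Rl-▷-cases {x = x} {y} e with m<1+n⇒m<n∨m≡n (proj₂ (Rl-bound (s ▷⟨ K , Q ⟩) x y e))
  ... | inj₁ y<n  = inj₁ (y<n , Rl-▷⁻ (<⇒≢ y<n) e)
  ... | inj₂ refl = inj₂ (refl , Rl-new⁻ e)

-- The conditions on (K, Q) under which the axioms (A1)–(A4) hold for all
-- triples whose last vertex is the one presented with row (K, Q).
record Admissible {n} (s : Pres n) (K Q : VSet) : Set where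
  field
    K-bounded : ∀ x → x ∈ᵛ K → x < n
    Q-bounded : ∀ x → x ∈ᵛ Q → x < n
    disjoint  : ∀ x → x ∈ᵛ K → ¬ x ∈ᵛ Q
    sq-K      : ∀ x y → Rl s sq x y → y ∈ᵛ K → x ∈ᵛ K
    sq-Q      : ∀ x y → Rl s sq x y → y ∈ᵛ Q → x ∈ᵛ K ⊎ x ∈ᵛ Q
    bt-K      : ∀ x y → Rl s bt x y → y ∈ᵛ K → ¬ x ∈ᵛ K
    pl-K      : ∀ x y → Rl s pl x y → ¬ x ∈ᵛ K
    pl-Q      : ∀ x y → Rl s pl x y → ¬ x ∈ᵛ Q

record CliqueIn {n} (s : Pres n) (S : VSet) (p : ℕ) : Set where
  constructor clique
  field
    vertex   : Fin p → ℕ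
    inside   : ∀ a → vertex a ∈ᵛ S
    adjacent : ∀ a b → a ≢ b → Edge s (vertex a) (vertex b)

NoCliqueIn : ∀ {n} → Pres n → VSet → ℕ → Set
NoCliqueIn s S p = ¬ CliqueIn s S p

NoCliqueIn-∅ : ∀ {n} {s : Pres n} {p} → NoCliqueIn s ∅ (suc p)
NoCliqueIn-∅ (clique _ inside _) = inside zero

CliqueIn-shrink : ∀ {n} {s : Pres n} {S p q} → p ≤ q → CliqueIn s S q → CliqueIn s S p
CliqueIn-shrink p≤q (clique f f∈S adjacent) =
  clique (f ∘ embed) (f∈S ∘ embed) λ a b a≢b → adjacent _ _ (a≢b ∘ inject≤-injective p≤q p≤q a b)
  where embed = λ a → inject≤ a p≤q

-- A clique meets the independent set Y in at most one vertex.
CliqueIn-∪-independent : ∀ {n} {s : Pres n} {S Y p} → (∀ x y → x ∈ᵛ Y → y ∈ᵛ Y → ¬ Edge s x y) →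
                         CliqueIn s (S ∪ Y) (suc p) → CliqueIn s S p
CliqueIn-∪-independent {S = S} {Y} independent (clique f f∈S∪Y adjacent)
  with any? (λ a → T? (Y (f a)))
... | yes (a₀ , fa₀∈Y) =
  clique (f ∘ punchIn a₀) g∈S λ i j i≢j → adjacent _ _ (i≢j ∘ punchIn-injective a₀ i j)
  where
  g∈S : ∀ i → f (punchIn a₀ i) ∈ᵛ S
  g∈S i = [ id
          , (λ x∈Y → contradiction (adjacent _ a₀ (punchInᵢ≢i a₀ i)) (independent _ _ x∈Y fa₀∈Y)) ]′
            (∪⁻ S Y (f∈S∪Y (punchIn a₀ i)))
... | no ¬Y = clique (f ∘ suc) g∈S λ i j i≢j → adjacent _ _ (i≢j ∘ Fin-suc-injective)
  where
  g∈S : ∀ i → f (suc i) ∈ᵛ S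
  g∈S i = [ id , (λ x∈Y → contradiction (suc i , x∈Y) ¬Y) ]′ (∪⁻ S Y (f∈S∪Y (suc i)))

module _ {n} {s : Pres n} {K Q : VSet} (adm : Admissible s K Q) where
  open Admissible adm

  private
    s′ = s ▷⟨ K , Q ⟩

    below : ∀ {ℓ x y} → Rl s′ ℓ x y → y < n → Rl s ℓ x y
    below e y<n = Rl-▷⁻ s K Q (<⇒≢ y<n) e

    below-old : ∀ {ℓ ℓ′ x y z} → Rl s′ ℓ x y → Rl s ℓ′ y z → z < n → Rl s ℓ x y
    below-old {y = y} {z} xy yz z<n = below xy (<-trans (proj₁ (Rl-bound s y z yz)) z<n)

    below-new : ∀ {ℓ ℓ′ x y} → Rl s′ ℓ x y → Rl s′ ℓ′ y n → Rl s ℓ x y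
    below-new {y = y} xy yn = below xy (proj₁ (Rl-bound s′ y n yn))

    to-new : ∀ {ℓ ℓ′ ℓ″ x y} → Rl s′ ℓ′ x y → Rl s′ ℓ″ y n → LabelView K Q x ℓ → Rl s′ ℓ x n
    to-new {x = x} {y} xy yn =
      Rl-new⁺ s K Q (<-trans (proj₁ (Rl-bound s′ x y xy)) (proj₁ (Rl-bound s′ y n yn)))

  ▷-Axioms : Axioms s → Axioms s′
  ▷-Axioms (A1 , A2 , A3 , A4) = A1′ , A2′ , A3′ , A4′
    where
    A1′ : ∀ x y z → Rl s′ sq x y → Rl s′ sq y z → Rl s′ sq x z
    A1′ x y z xy yz with Rl-▷-cases s K Q yz
    ... | inj₁ (z<n , yz′)       = Rl-▷⁺ s K Q z<n (A1 x y z (below-old xy yz′ z<n) yz′)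
    ... | inj₂ (refl , in-K y∈K) = to-new xy yz (in-K (sq-K x y (below-new xy yz) y∈K))

    A2′ : ∀ x y z → Rl s′ sq x y → Rl s′ bt y z → Rl s′ sq x z ⊎ Rl s′ bt x z
    A2′ x y z xy yz with Rl-▷-cases s K Q yz
    ... | inj₁ (z<n , yz′) = Sum.map (Rl-▷⁺ s K Q z<n) (Rl-▷⁺ s K Q z<n) (A2 x y z (below-old xy yz′ z<n) yz′)
    ... | inj₂ (refl , in-Q _ y∈Q) with classify K Q x
    ...   | sq , v               = inj₁ (to-new xy yz v)
    ...   | bt , v               = inj₂ (to-new xy yz v)
    ...   | pl , outside x∉K x∉Q = ⊥-elim ([ x∉K , x∉Q ]′ (sq-Q x y (below-new xy yz) y∈Q))

    A3′ : ∀ x y z → Rl s′ bt x y → Rl s′ sq y z → Rl s′ bt x z ⊎ Rl s′ pl x z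
    A3′ x y z xy yz with Rl-▷-cases s K Q yz
    ... | inj₁ (z<n , yz′) = Sum.map (Rl-▷⁺ s K Q z<n) (Rl-▷⁺ s K Q z<n) (A3 x y z (below-old xy yz′ z<n) yz′)
    ... | inj₂ (refl , in-K y∈K) with classify K Q x
    ...   | sq , in-K x∈K = contradiction x∈K (bt-K x y (below-new xy yz) y∈K)
    ...   | bt , v        = inj₁ (to-new xy yz v)
    ...   | pl , v        = inj₂ (to-new xy yz v)

    A4′ : ∀ x y z → Rl s′ pl x y → y < z → z < suc n → Rl s′ pl x z
    A4′ x y z xy y<z z<1+n with m<1+n⇒m<n∨m≡n z<1+n
    ... | inj₁ z<n  = Rl-▷⁺ s K Q z<n (A4 x y z (below xy (<-trans y<z z<n)) y<z z<n)
    ... | inj₂ refl =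
      Rl-new⁺ s K Q (<-trans (proj₁ (Rl-bound s x y xy′)) y<z) (outside (pl-K x y xy′) (pl-Q x y xy′))
      where xy′ = below xy y<z

  Edge-▷⁻ : ∀ {x y} → x ≢ n → y ≢ n → Edge s′ x y → Edge s x y
  Edge-▷⁻ x≢n y≢n = Sum.map (Rl-▷⁻ s K Q y≢n) (Rl-▷⁻ s K Q x≢n)

  Edge-new⁻ : ∀ {x} → Edge s′ x n → x ∈ᵛ Q
  Edge-new⁻ {x} (inj₁ e) with Rl-new⁻ s K Q e
  ... | in-Q _ x∈Q = x∈Q
  Edge-new⁻ {x} (inj₂ e) with Rl-bound s′ n x e
  ... | n<x , x<1+n = contradiction (≤-pred x<1+n) (<⇒≱ n<x)

  -- A (k+1)-clique through the new vertex would leave a k-clique inside Q.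
  ▷-CliqueAtMost : ∀ {k} → CliqueAtMost k s → NoCliqueIn s Q k → CliqueAtMost k s′
  ▷-CliqueAtMost C noQ (f , adjacent) with any? (λ a → f a ≟ n)
  ... | no ¬new          = C (f , λ a b a≢b →
                             Edge-▷⁻ (¬new ∘ (a ,_)) (¬new ∘ (b ,_)) (adjacent a b a≢b))
  ... | yes (a₀ , fa₀≡n) = noQ (clique g g∈Q λ i j i≢j →
                             Edge-▷⁻ (<⇒≢ (Q-bounded _ (g∈Q i))) (<⇒≢ (Q-bounded _ (g∈Q j)))
                               (adjacent _ _ (i≢j ∘ punchIn-injective a₀ i j)))
    where
    g = f ∘ punchIn a₀
    g∈Q : ∀ i → g i ∈ᵛ Q
    g∈Q i = Edge-new⁻ (subst (Edge s′ (g i)) fa₀≡n (adjacent _ a₀ (punchInᵢ≢i a₀ i)))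

  private
    K′ = K ∪ ｛ n ｝

    old-K : ∀ {x} → x < n → x ∈ᵛ K′ → x ∈ᵛ K
    old-K {x} x<n x∈K′ with ∪⁻ K ｛ n ｝ x∈K′
    ... | inj₁ x∈K = x∈K
    ... | inj₂ x≡n = contradiction (∈｛｝⁻ x≡n) (<⇒≢ x<n)

  -- The next vertex is placed ⊐-below the vertex just presented.
  Admissible-▷ : Admissible s′ K′ Q
  Admissible-▷ = record
    { K-bounded = K′-bounded
    ; Q-bounded = λ x → m<n⇒m<1+n ∘ Q-bounded x
    ; disjoint  = λ x x∈K′ x∈Q → disjoint x (old-K (Q-bounded x x∈Q) x∈K′) x∈Q
    ; sq-K      = sq-K′
    ; sq-Q      = sq-Q′
    ; bt-K      = bt-K′
    ; pl-K      = pl-K′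
    ; pl-Q      = pl-Q′
    }
    where
    K′-bounded : ∀ x → x ∈ᵛ K′ → x < suc n
    K′-bounded x x∈K′ with ∪⁻ K ｛ n ｝ x∈K′
    ... | inj₁ x∈K = m<n⇒m<1+n (K-bounded x x∈K)
    ... | inj₂ x≡n = s≤s (≤-reflexive (∈｛｝⁻ x≡n))

    sq-K′ : ∀ x y → Rl s′ sq x y → y ∈ᵛ K′ → x ∈ᵛ K′
    sq-K′ x y xy y∈K′ with Rl-▷-cases s K Q xy
    ... | inj₁ (y<n , xy′)       = ∪⁺ˡ K ｛ n ｝ (sq-K x y xy′ (old-K y<n y∈K′))
    ... | inj₂ (refl , in-K x∈K) = ∪⁺ˡ K ｛ n ｝ x∈K

    sq-Q′ : ∀ x y → Rl s′ sq x y → y ∈ᵛ Q → x ∈ᵛ K′ ⊎ x ∈ᵛ Q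
    sq-Q′ x y xy y∈Q with Rl-▷-cases s K Q xy
    ... | inj₁ (y<n , xy′) = Sum.map₁ (∪⁺ˡ K ｛ n ｝) (sq-Q x y xy′ y∈Q)
    ... | inj₂ (refl , _)  = contradiction (Q-bounded y y∈Q) (<-irrefl refl)

    bt-K′ : ∀ x y → Rl s′ bt x y → y ∈ᵛ K′ → ¬ x ∈ᵛ K′
    bt-K′ x y xy y∈K′ x∈K′ with Rl-▷-cases s K Q xy
    ... | inj₁ (y<n , xy′) =
      bt-K x y xy′ (old-K y<n y∈K′) (old-K (<-trans (proj₁ (Rl-bound s x y xy′)) y<n) x∈K′)
    ... | inj₂ (refl , in-Q x∉K _) = x∉K (old-K (proj₁ (Rl-bound s′ x y xy)) x∈K′)

    pl-K′ : ∀ x y → Rl s′ pl x y → ¬ x ∈ᵛ K′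
    pl-K′ x y xy x∈K′ with Rl-▷-cases s K Q xy
    ... | inj₁ (y<n , xy′) = pl-K x y xy′ (old-K (<-trans (proj₁ (Rl-bound s x y xy′)) y<n) x∈K′)
    ... | inj₂ (refl , outside x∉K _) = x∉K (old-K (proj₁ (Rl-bound s′ x y xy)) x∈K′)

    pl-Q′ : ∀ x y → Rl s′ pl x y → ¬ x ∈ᵛ Q
    pl-Q′ x y xy with Rl-▷-cases s K Q xy
    ... | inj₁ (_ , xy′)              = pl-Q x y xy′
    ... | inj₂ (refl , outside _ x∉Q) = x∉Q

Admissible-K-independent : ∀ {n} {s : Pres n} {K Q} → Admissible s K Q →
                           ∀ x y → x ∈ᵛ K → y ∈ᵛ K → ¬ Edge s x y
Admissible-K-independent adm x y x∈K y∈K (inj₁ xy) = Admissible.bt-K adm x y xy y∈K x∈K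
Admissible-K-independent adm x y x∈K y∈K (inj₂ yx) = Admissible.bt-K adm y x yx x∈K y∈K

Admissible-∅ : ∀ {n} {s : Pres n} → Admissible s ∅ ∅
Admissible-∅ = record
  { K-bounded = λ _ () ; Q-bounded = λ _ () ; disjoint = λ _ ()
  ; sq-K = λ _ _ _ () ; sq-Q = λ _ _ _ () ; bt-K = λ _ _ _ () ; pl-K = λ _ _ _ () ; pl-Q = λ _ _ _ () }

Admissible-cong : ∀ {n} {s : Pres n} {K Q K′ Q′} → (∀ x → K x ≡ K′ x) → (∀ x → Q x ≡ Q′ x) →
                  Admissible s K Q → Admissible s K′ Q′
Admissible-cong {K = K} {Q} {K′} {Q′} K≗K′ Q≗Q′ adm = record
  { K-bounded = λ x → K-bounded x ∘ from K≗K′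
  ; Q-bounded = λ x → Q-bounded x ∘ from Q≗Q′
  ; disjoint  = λ x x∈K x∈Q → disjoint x (from K≗K′ x∈K) (from Q≗Q′ x∈Q)
  ; sq-K      = λ x y xy → to K≗K′ ∘ sq-K x y xy ∘ from K≗K′
  ; sq-Q      = λ x y xy → Sum.map (to K≗K′) (to Q≗Q′) ∘ sq-Q x y xy ∘ from Q≗Q′
  ; bt-K      = λ x y xy y∈K x∈K → bt-K x y xy (from K≗K′ y∈K) (from K≗K′ x∈K)
  ; pl-K      = λ x y xy → pl-K x y xy ∘ from K≗K′
  ; pl-Q      = λ x y xy → pl-Q x y xy ∘ from Q≗Q′
  }
  where
  open Admissible adm
  to : ∀ {A B : VSet} → (∀ x → A x ≡ B x) → ∀ {x} → x ∈ᵛ A → x ∈ᵛ B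
  to A≗B {x} = subst T (A≗B x)
  from : ∀ {A B : VSet} → (∀ x → A x ≡ B x) → ∀ {x} → x ∈ᵛ B → x ∈ᵛ A
  from A≗B {x} = subst T (sym (A≗B x))

module _ {n} {s : Pres n} {Y : VSet} {n₀ : ℕ} (Y-after : ∀ x → x ∈ᵛ Y → n₀ ≤ x) where

  private
    ∉Y : ∀ {ℓ x y} → Rl s ℓ x y → y < n₀ → ¬ x ∈ᵛ Y
    ∉Y {x = x} {y} xy y<n₀ x∈Y = <⇒≱ (<-trans (proj₁ (Rl-bound s x y xy)) y<n₀) (Y-after x x∈Y)

  -- The vertices of Y, presented after those of P, change from lying ⊐-above
  -- the next vertex to being adjacent to it.
  Admissible-move : ∀ {P Q} → (∀ x → x ∈ᵛ P → x < n₀) → Admissible s (P ∪ Y) Q → Admissible s P (Q ∪ Y)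
  Admissible-move {P} {Q} P-before adm = record
    { K-bounded = λ x → K-bounded x ∘ ∪⁺ˡ P Y
    ; Q-bounded = λ x → [ Q-bounded x , K-bounded x ∘ ∪⁺ʳ P Y ]′ ∘ ∪⁻ Q Y
    ; disjoint  = λ x x∈P → [ disjoint x (∪⁺ˡ P Y x∈P) , <⇒≱ (P-before x x∈P) ∘ Y-after x ]′ ∘ ∪⁻ Q Y
    ; sq-K      = sq-P
    ; sq-Q      = sq-QY
    ; bt-K      = λ x y xy y∈P x∈P → bt-K x y xy (∪⁺ˡ P Y y∈P) (∪⁺ˡ P Y x∈P)
    ; pl-K      = λ x y xy → pl-K x y xy ∘ ∪⁺ˡ P Y
    ; pl-Q      = λ x y xy → [ pl-Q x y xy , pl-K x y xy ∘ ∪⁺ʳ P Y ]′ ∘ ∪⁻ Q Y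
    }
    where
    open Admissible adm
    sq-P : ∀ x y → Rl s sq x y → y ∈ᵛ P → x ∈ᵛ P
    sq-P x y xy y∈P with ∪⁻ P Y (sq-K x y xy (∪⁺ˡ P Y y∈P))
    ... | inj₁ x∈P = x∈P
    ... | inj₂ x∈Y = contradiction x∈Y (∉Y xy (P-before y y∈P))

    in-P∪Y : ∀ {x} → x ∈ᵛ (P ∪ Y) → x ∈ᵛ P ⊎ x ∈ᵛ (Q ∪ Y)
    in-P∪Y = Sum.map₂ (∪⁺ʳ Q Y) ∘ ∪⁻ P Y

    sq-QY : ∀ x y → Rl s sq x y → y ∈ᵛ (Q ∪ Y) → x ∈ᵛ P ⊎ x ∈ᵛ (Q ∪ Y)
    sq-QY x y xy y∈Q∪Y with ∪⁻ Q Y y∈Q∪Y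
    ... | inj₂ y∈Y = in-P∪Y (sq-K x y xy (∪⁺ʳ P Y y∈Y))
    ... | inj₁ y∈Q = [ in-P∪Y , inj₂ ∘ ∪⁺ˡ Q Y ]′ (sq-Q x y xy y∈Q)

  Admissible-drop : ∀ {K Q} → (∀ x → x ∈ᵛ Q → x < n₀) → Admissible s K (Q ∪ Y) → Admissible s K Q
  Admissible-drop {K} {Q} Q-before adm = record
    { K-bounded = K-bounded
    ; Q-bounded = λ x → Q-bounded x ∘ ∪⁺ˡ Q Y
    ; disjoint  = λ x x∈K → disjoint x x∈K ∘ ∪⁺ˡ Q Y
    ; sq-K      = sq-K
    ; sq-Q      = sq-Q′
    ; bt-K      = bt-K
    ; pl-K      = pl-K
    ; pl-Q      = λ x y xy → pl-Q x y xy ∘ ∪⁺ˡ Q Y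
    }
    where
    open Admissible adm
    sq-Q′ : ∀ x y → Rl s sq x y → y ∈ᵛ Q → x ∈ᵛ K ⊎ x ∈ᵛ Q
    sq-Q′ x y xy y∈Q with sq-Q x y xy (∪⁺ˡ Q Y y∈Q)
    ... | inj₁ x∈K = inj₁ x∈K
    ... | inj₂ x∈Q∪Y = inj₂ ([ id , (λ x∈Y → contradiction x∈Y (∉Y xy (Q-before y y∈Q))) ]′ (∪⁻ Q Y x∈Q∪Y))

size : State → ℕ
size = proj₁

pres : (w : State) → Pres (size w)
pres w = proj₁ (proj₂ w)

colours : (w : State) → Vec ℕ (size w)
colours w = proj₂ (proj₂ w)

colour : State → ℕ → Maybe ℕ
colour w = vget (colours w)

present : State → VSet → VSet → ℕ → State
present w K Q c = suc (size w) , pres w ▷⟨ K , Q ⟩ , colours w ∷ʳ c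

vget-∷ʳ-old : ∀ {A : Set} {m} (v : Vec A m) a {x} → x < m → vget (v ∷ʳ a) x ≡ vget v x
vget-∷ʳ-old (_ ∷ _) a {zero}  _         = refl
vget-∷ʳ-old (_ ∷ v) a {suc x} (s≤s x<m) = vget-∷ʳ-old v a x<m

vget-∷ʳ-new : ∀ {A : Set} {m} (v : Vec A m) a → vget (v ∷ʳ a) m ≡ just a
vget-∷ʳ-new []      a = refl
vget-∷ʳ-new (_ ∷ v) a = vget-∷ʳ-new v a

vget-lookup : ∀ {A : Set} {m} (v : Vec A m) i → vget v (toℕ i) ≡ just (lookup v i)
vget-lookup (_ ∷ _) zero    = refl
vget-lookup (_ ∷ v) (suc i) = vget-lookup v i

data _≼_ (w : State) : State → Set where
  ≼-refl    : w ≼ w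
  ≼-present : ∀ {w′} K Q c → w ≼ w′ → w ≼ present w′ K Q c

≼-trans : ∀ {w₁ w₂ w₃} → w₁ ≼ w₂ → w₂ ≼ w₃ → w₁ ≼ w₃
≼-trans w₁≼w₂ ≼-refl               = w₁≼w₂
≼-trans w₁≼w₂ (≼-present K Q c w₂≼w) = ≼-present K Q c (≼-trans w₁≼w₂ w₂≼w)

≼-size : ∀ {w w′} → w ≼ w′ → size w ≤ size w′
≼-size ≼-refl                = ≤-refl
≼-size (≼-present _ _ _ w≼w′) = m≤n⇒m≤1+n (≼-size w≼w′)

Rl-≼⁻ : ∀ {w w′ ℓ x y} → w ≼ w′ → y < size w → Rl (pres w′) ℓ x y → Rl (pres w) ℓ x y
Rl-≼⁻ ≼-refl                           _     e = e
Rl-≼⁻ (≼-present {w′} K Q _ w≼w′) y<n e =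
  Rl-≼⁻ w≼w′ y<n (Rl-▷⁻ (pres w′) K Q (<⇒≢ (≤-trans y<n (≼-size w≼w′))) e)

Edge-≼⁻ : ∀ {w w′ x y} → w ≼ w′ → x < size w → y < size w → Edge (pres w′) x y → Edge (pres w) x y
Edge-≼⁻ w≼w′ x<n y<n = Sum.map (Rl-≼⁻ w≼w′ y<n) (Rl-≼⁻ w≼w′ x<n)

colour-≼ : ∀ {w w′ x} → w ≼ w′ → x < size w → colour w′ x ≡ colour w x
colour-≼ ≼-refl                            _   = refl
colour-≼ (≼-present {w′} _ _ c w≼w′) x<n =
  trans (vget-∷ʳ-old (colours w′) c (≤-trans x<n (≼-size w≼w′))) (colour-≼ w≼w′ x<n)

CliqueIn-≼⁻ : ∀ {w w′ S p} → w ≼ w′ → (∀ x → x ∈ᵛ S → x < size w) →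
              CliqueIn (pres w′) S p → CliqueIn (pres w) S p
CliqueIn-≼⁻ w≼w′ S-bounded (clique f f∈S adjacent) =
  clique f f∈S λ a b a≢b → Edge-≼⁻ w≼w′ (S-bounded _ (f∈S a)) (S-bounded _ (f∈S b)) (adjacent a b a≢b)

_∖_ : List ℕ → List ℕ → List ℕ
xs ∖ ys = filter (_∉? ys) xs

_∪ˡ_ : List ℕ → List ℕ → List ℕ
xs ∪ˡ ys = xs ++ ys ∖ xs

∈-∖⁻ : ∀ {c} xs ys → c ∈ xs ∖ ys → c ∈ xs × c ∉ ys
∈-∖⁻ _ ys = ∈-filter⁻ (_∉? ys)

∈-∖⁺ : ∀ {c xs ys} → c ∈ xs → c ∉ ys → c ∈ xs ∖ ys
∈-∖⁺ = ∈-filter⁺ (_∉? _)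

∈-∪ˡ⁻ : ∀ {c} xs ys → c ∈ xs ∪ˡ ys → c ∈ xs ⊎ c ∈ ys ∖ xs
∈-∪ˡ⁻ xs _ = ∈-++⁻ xs

length-∪ˡ : ∀ xs ys → length (xs ∪ˡ ys) ≡ length xs + length (ys ∖ xs)
length-∪ˡ xs ys = length-++ xs

Unique-∪ˡ : ∀ {xs ys} → Unique xs → Unique ys → Unique (xs ∪ˡ ys)
Unique-∪ˡ {ys = ys} uxs uys =
  Unique.++⁺ uxs (Unique.filter⁺ (_∉? _) uys) (λ (c∈xs , c∈ys∖xs) → proj₂ (∈-∖⁻ ys _ c∈ys∖xs) c∈xs)

Unique-lookup-injective : ∀ {A : Set} {xs : List A} → Unique xs →
                          ∀ i j → List.lookup xs i ≡ List.lookup xs j → i ≡ j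
Unique-lookup-injective (_   ∷ _) zero    zero    _ = refl
Unique-lookup-injective (x≢ ∷ _) zero    (suc j) e = contradiction e (All.lookup x≢ (∈-lookup j))
Unique-lookup-injective (x≢ ∷ _) (suc i) zero    e = contradiction (sym e) (All.lookup x≢ (∈-lookup i))
Unique-lookup-injective (_   ∷ u) (suc i) (suc j) e = cong suc (Unique-lookup-injective u i j e)

length-≤-⊆ : ∀ {A : Set} {xs ys : List A} → Unique xs → xs ⊆ ys → length xs ≤ length ys
length-≤-⊆ {A} {xs} u xs⊆ys = injective⇒≤ injective
  where
  position : Fin (length xs) → Fin _
  position i = Any.index (xs⊆ys (∈-lookup i))
  injective : ∀ {i j} → position i ≡ position j → i ≡ j
  injective {i} {j} e = Unique-lookup-injective u i j
    (index-injective (setoid A) (xs⊆ys (∈-lookup i)) (xs⊆ys (∈-lookup j)) e)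

UsesAtLeast-from : ∀ {N} w R → Unique R → N ≤ length R →
                 (∀ {c} → c ∈ R → ∃ λ x → x < size w × colour w x ≡ just c) → UsesAtLeast N w
UsesAtLeast-from w R u N≤R realised = vertex , injective
  where
  index : Fin _ → Fin (length R)
  index a = inject≤ a N≤R
  witness = λ a → realised (∈-lookup (index a))
  vertex : Fin _ → Fin (size w)
  vertex a = fromℕ< (proj₁ (proj₂ (witness a)))
  coloured : ∀ a → just (lookup (colours w) (vertex a)) ≡ just (List.lookup R (index a))
  coloured a = begin
    just (lookup (colours w) (vertex a))   ≡⟨ vget-lookup (colours w) (vertex a) ⟨
    colour w (toℕ (vertex a))              ≡⟨ cong (colour w) (toℕ-fromℕ< _) ⟩
    colour w (proj₁ (witness a))           ≡⟨ proj₂ (proj₂ (witness a)) ⟩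
    just (List.lookup R (index a))         ∎
    where open ≡-Reasoning
  injective : ∀ a b → lookup (colours w) (vertex a) ≡ lookup (colours w) (vertex b) → a ≡ b
  injective a b e = inject≤-injective N≤R N≤R a b (Unique-lookup-injective u _ _
    (just-injective (trans (sym (coloured a)) (trans (cong just e) (coloured b)))))

-- Counting presentation scenarios

length-cartesianProductWith : ∀ {A B C : Set} (f : A → B → C) xs ys →
                              length (cartesianProductWith f xs ys) ≡ length xs * length ys
length-cartesianProductWith f []       ys = refl
length-cartesianProductWith f (x ∷ xs) ys = begin
  length (map (f x) ys ++ cartesianProductWith f xs ys)         ≡⟨ length-++ (map (f x) ys) ⟩
  length (map (f x) ys) + length (cartesianProductWith f xs ys) ≡⟨ cong₂ _+_ (length-map (f x) ys)
                                                                     (length-cartesianProductWith f xs ys) ⟩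
  length ys + length xs * length ys                             ∎
  where open ≡-Reasoning

labels : List Lab
labels = sq ∷ bt ∷ pl ∷ []

∈-labels : ∀ ℓ → ℓ ∈ labels
∈-labels sq = here refl
∈-labels bt = there (here refl)
∈-labels pl = there (there (here refl))

rows : (n : ℕ) → List (Vec Lab n)
rows zero    = [] ∷ []
rows (suc n) = cartesianProductWith _∷_ labels (rows n)

∈-rows : ∀ {n} (v : Vec Lab n) → v ∈ rows n
∈-rows []      = here refl
∈-rows (ℓ ∷ v) = ∈-cartesianProductWith⁺ _∷_ (∈-labels ℓ) (∈-rows v)

length-rows : ∀ n → length (rows n) ≡ 3 ^ n
length-rows zero    = refl
length-rows (suc n) =
  trans (length-cartesianProductWith _∷_ labels (rows n)) (cong (3 *_) (length-rows n))

scenarios : (n : ℕ) → List (Pres n)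
scenarios zero    = [] ∷ []
scenarios (suc n) = cartesianProductWith _▷_ (scenarios n) (rows n)

∈-scenarios : ∀ {n} (s : Pres n) → s ∈ scenarios n
∈-scenarios []      = here refl
∈-scenarios (s ▷ v) = ∈-cartesianProductWith⁺ _▷_ (∈-scenarios s) (∈-rows v)

length-scenarios : ∀ n → length (scenarios n) ≤ 4 ^ (n * n)
length-scenarios zero    = ≤-refl
length-scenarios (suc n) = begin
  length (scenarios (suc n))              ≡⟨ length-cartesianProductWith _▷_ (scenarios n) (rows n) ⟩
  length (scenarios n) * length (rows n)  ≡⟨ cong (length (scenarios n) *_) (length-rows n) ⟩
  length (scenarios n) * 3 ^ n            ≤⟨ *-mono-≤ (length-scenarios n) (^-monoˡ-≤ n (n≤1+n 3)) ⟩
  4 ^ (n * n) * 4 ^ n                     ≡⟨ ^-distribˡ-+-* 4 (n * n) n ⟨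
  4 ^ (n * n + n)                         ≤⟨ ^-monoʳ-≤ 4 (≤-trans (m≤n+m _ (suc n)) (≤-reflexive square)) ⟩
  4 ^ (suc n * suc n)                     ∎
  where
  open ≤-Reasoning
  square : suc n + (n * n + n) ≡ suc n * suc n
  square = cong (suc n +_) (trans (+-comm (n * n) n) (sym (*-suc n n)))

tagged : ∀ {n} → Pres n → Σ ℕ Pres
tagged {n} s = n , s

scenariosUpTo : ℕ → List (Σ ℕ Pres)
scenariosUpTo zero    = map tagged (scenarios 0)
scenariosUpTo (suc r) = scenariosUpTo r ++ map tagged (scenarios (suc r))

∈-scenariosUpTo : ∀ {r n} (s : Pres n) → n ≤ r → (n , s) ∈ scenariosUpTo r
∈-scenariosUpTo {zero}  s z≤n = ∈-map⁺ tagged (∈-scenarios s)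
∈-scenariosUpTo {suc r} s n≤1+r with m≤n⇒m<n∨m≡n n≤1+r
... | inj₁ n<1+r = ∈-++⁺ˡ (∈-scenariosUpTo s (≤-pred n<1+r))
... | inj₂ refl  = ∈-++⁺ʳ (scenariosUpTo r) (∈-map⁺ tagged (∈-scenarios s))

length-scenariosUpTo : ∀ r → length (scenariosUpTo r) ≤ suc r * 4 ^ (r * r)
length-scenariosUpTo zero    = ≤-reflexive (length-map tagged (scenarios 0))
length-scenariosUpTo (suc r) = begin
  length (scenariosUpTo r ++ map tagged (scenarios (suc r)))
    ≡⟨ length-++ (scenariosUpTo r) ⟩
  length (scenariosUpTo r) + length (map tagged (scenarios (suc r)))
    ≡⟨ cong (length (scenariosUpTo r) +_) (length-map tagged (scenarios (suc r))) ⟩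
  length (scenariosUpTo r) + length (scenarios (suc r))
    ≤⟨ +-mono-≤ (length-scenariosUpTo r) (length-scenarios (suc r)) ⟩
  suc r * 4 ^ (r * r) + 4 ^ (suc r * suc r)
    ≤⟨ +-monoˡ-≤ _ (*-monoʳ-≤ (suc r) (^-monoʳ-≤ 4 (*-mono-≤ (n≤1+n r) (n≤1+n r)))) ⟩
  suc r * 4 ^ (suc r * suc r) + 4 ^ (suc r * suc r)
    ≡⟨ +-comm (suc r * 4 ^ (suc r * suc r)) _ ⟩
  suc (suc r) * 4 ^ (suc r * suc r)
    ∎
  where open ≤-Reasoning

-- Presenter strategies as decision trees

-- A presenter decision tree: ask K Q presents a vertex with row (K, Q) and
-- continues according to the colour Algorithm gives it.
data Plan : Set where
  stop : Plan
  ask  : VSet → VSet → (ℕ → Plan) → Plan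

follow : Plan → List ℕ → Plan
follow P              []       = P
follow stop           (_ ∷ _)  = stop
follow (ask _ _ next) (c ∷ cs) = follow (next c) cs

follow-++ : ∀ P cs ds → follow P (cs ++ ds) ≡ follow (follow P cs) ds
follow-++ P              []       ds       = refl
follow-++ stop           (_ ∷ _)  []       = refl
follow-++ stop           (_ ∷ _)  (_ ∷ _)  = refl
follow-++ (ask _ _ next) (c ∷ cs) ds       = follow-++ (next c) cs ds

nextRow : (n : ℕ) → Plan → Maybe (Vec Lab n)
nextRow n stop        = nothing
nextRow n (ask K Q _) = just (row n K Q)

planStrategy : Plan → Strategy
planStrategy P n _ cs = nextRow n (follow P (toList cs))

Avoids : State → VSet → ℕ → Set
Avoids w Q c = ∀ x → x ∈ᵛ Q → colour w x ≢ just c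

data Winning (k r N : ℕ) (w : State) : Plan → Set where
  stop : size w ≤ r → UsesAtLeast N w → Winning k r N w stop
  ask  : ∀ {K Q next} → Admissible (pres w) K Q → NoCliqueIn (pres w) Q k → size w < r →
         (∀ c → Avoids w Q c → Winning k r N (present w K Q c) (next c)) →
         Winning k r N w (ask K Q next)

Winning-size : ∀ {k r N w P} → Winning k r N w P → size w ≤ r
Winning-size (stop w≤r _)    = w≤r
Winning-size (ask _ _ w<r _) = <⇒≤ w<r

Proper-Avoids : ∀ {A} → Proper A → ∀ w {K Q} → Admissible (pres w) K Q →
                Avoids w Q (A (size w) (pres w ▷⟨ K , Q ⟩) (colours w))
Proper-Avoids proper w {K} {Q} adm x x∈Q colour≡ =
  proper (size w) (pres w ▷⟨ K , Q ⟩) (colours w) (fromℕ< x<n) edge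
    (just-injective (trans (sym colour≡) (trans (cong (colour w) (sym (toℕ-fromℕ< x<n)))
                                                  (vget-lookup (colours w) (fromℕ< x<n)))))
  where
  open Admissible adm
  x<n = Q-bounded x x∈Q
  edge : Edge (pres w ▷⟨ K , Q ⟩) (toℕ (fromℕ< x<n)) (size w)
  edge rewrite toℕ-fromℕ< x<n = inj₁ (Rl-new⁺ (pres w) K Q x<n (in-Q (λ x∈K → disjoint x x∈K x∈Q) x∈Q))

step-nothing : ∀ S A w → S (size w) (pres w) (colours w) ≡ nothing → step S A w ≡ w
step-nothing S A w eq rewrite eq = refl

step-just : ∀ S A w {r} → S (size w) (pres w) (colours w) ≡ just r →
            step S A w ≡ (suc (size w) , pres w ▷ r , colours w ∷ʳ A (size w) (pres w ▷ r) (colours w))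
step-just S A w eq rewrite eq = refl

Legal-[] : ∀ {k} → 1 ≤ k → Legal k []
Legal-[] (s≤s z≤n) = ((λ _ _ _ ()) , (λ _ _ _ ()) , (λ _ _ _ ()) , (λ _ _ _ ())) , no-edge
  where
  no-edge : CliqueAtMost _ []
  no-edge (_ , adjacent) with adjacent zero (suc zero) (λ ())
  ... | inj₁ ()
  ... | inj₂ ()

module _ {k r N : ℕ} (P : Plan) where

  private
    S = planStrategy P

  current : State → Plan
  current w = follow P (toList (colours w))

  Invariant : ℕ → State → Set
  Invariant t w = Legal k (pres w) × Winning k r N w (current w) × (size w ≡ t ⊎ current w ≡ stop)

  Invariant-step : ∀ A → Proper A → ∀ {t} w → Invariant t w → Invariant (suc t) (step S A w)
  Invariant-step A proper {t} w (legal , win , progress) = go (current w) refl win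
    where
    go : ∀ Pw → current w ≡ Pw → Winning k r N w Pw → Invariant (suc t) (step S A w)
    go stop eq win′ rewrite step-nothing S A w (cong (nextRow (size w)) eq) =
      legal , subst (Winning k r N w) (sym eq) win′ , inj₂ eq
    go (ask K Q next) eq (ask adm noQ _ winning)
      rewrite step-just S A w (cong (nextRow (size w)) eq) =
        (▷-Axioms adm (proj₁ legal) , ▷-CliqueAtMost adm (proj₂ legal) noQ) ,
        subst (Winning k r N w′) (sym current≡) (winning c (Proper-Avoids proper w adm)) ,
        Sum.map (cong suc) (λ stopped → contradiction (trans (sym eq) stopped) λ ()) progress
      where
      c  = A (size w) (pres w ▷⟨ K , Q ⟩) (colours w)
      w′ = present w K Q c
      current≡ : current w′ ≡ next c
      current≡ = begin
        follow P (toList (colours w ∷ʳ c))        ≡⟨ cong (follow P) (toList-∷ʳ c (colours w)) ⟩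
        follow P (toList (colours w) ++ c ∷ [])   ≡⟨ follow-++ P (toList (colours w)) (c ∷ []) ⟩
        follow (current w) (c ∷ [])               ≡⟨ cong (λ Pw → follow Pw (c ∷ [])) eq ⟩
        next c                                    ∎
        where open ≡-Reasoning

  Invariant-final : ∀ {t} w → r ≤ t → Invariant t w → UsesAtLeast N w
  Invariant-final w r≤t (_ , win , progress) = go (current w) refl win
    where
    go : ∀ Pw → current w ≡ Pw → Winning k r N w Pw → UsesAtLeast N w
    go stop _ (stop _ used) = used
    go (ask _ _ _) eq (ask _ _ w<r _) =
      [ (λ { refl → contradiction r≤t (<⇒≱ w<r) })
      , (λ stopped → contradiction (trans (sym eq) stopped) λ ()) ]′ progress

  Winning-Forces : ∀ {R B} → 1 ≤ k → Winning k r N (0 , [] , []) P → r ≤ R →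
                   length (scenariosUpTo r) ≤ B → Forces k S N R B
  Winning-Forces {R} k≥1 win r≤R enough = legal , used , scenariosUpTo r , enough , occurs
    where
    invariant : ∀ A → Proper A → ∀ t → Invariant t (play S A t)
    invariant A proper zero    = Legal-[] k≥1 , win , inj₁ refl
    invariant A proper (suc t) = Invariant-step A proper (play S A t) (invariant A proper t)

    legal : ∀ A → Proper A → ∀ t → Legal k (pres (play S A t))
    legal A proper t = proj₁ (invariant A proper t)

    used : ∀ A → Proper A → UsesAtLeast N (play S A R)
    used A proper = Invariant-final (play S A R) r≤R (invariant A proper R)

    occurs : ∀ A → Proper A → ∀ t → scenario (play S A (suc t)) ∈ scenariosUpTo r
    occurs A proper t = ∈-scenariosUpTo _ (Winning-size (proj₁ (proj₂ (invariant A proper (suc t)))))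

-- The forcing strategy

-- Forced w t g K Q w′ B R: Presenter went from w to w′ by presenting at most t
-- vertices B, after which a vertex may still be presented ⊐-below K ∪ B and
-- adjacent to Q; B carries g or more distinct colours R, none used on Q.
record Forced (w : State) (t g : ℕ) (K Q : VSet) (w′ : State) (B : VSet) (R : List ℕ) : Set where
  field
    extends    : w ≼ w′
    rounds     : size w′ ≤ size w + t
    fresh      : ∀ x → x ∈ᵛ B → size w ≤ x
    admissible : Admissible (pres w′) (K ∪ B) Q
    realised   : ∀ {c} → c ∈ R → ∃ λ x → x ∈ᵛ B × colour w′ x ≡ just c
    distinct   : Unique R
    many       : g ≤ length R
    avoids     : ∀ {c} → c ∈ R → Avoids w′ Q c

  B-bounded : ∀ x → x ∈ᵛ B → x < size w′
  B-bounded x = Admissible.K-bounded admissible x ∘ ∪⁺ʳ K B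

  realised-≼ : ∀ {w″ c} → w′ ≼ w″ → c ∈ R → ∃ λ x → x ∈ᵛ B × colour w″ x ≡ just c
  realised-≼ w′≼w″ c∈R with realised c∈R
  ... | x , x∈B , coloured = x , x∈B , trans (colour-≼ w′≼w″ (B-bounded x x∈B)) coloured

  avoids-≼ : ∀ {w″ c} → w′ ≼ w″ → c ∈ R → Avoids w″ Q c
  avoids-≼ w′≼w″ c∈R x x∈Q =
    avoids c∈R x x∈Q ∘ trans (sym (colour-≼ w′≼w″ (Admissible.Q-bounded admissible x x∈Q)))

open Forced

Forced-leaf : ∀ {w K Q} → Admissible (pres w) K Q → ∀ c → Avoids w Q c →
              Forced w 1 1 K Q (present w K Q c) ｛ size w ｝ (c ∷ [])
Forced-leaf {w} {K} {Q} adm c avoid = record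
  { extends    = ≼-present K Q c ≼-refl
  ; rounds     = ≤-reflexive (+-comm 1 (size w))
  ; fresh      = λ x → ≤-reflexive ∘ sym ∘ ∈｛｝⁻
  ; admissible = Admissible-▷ adm
  ; realised   = λ { (here refl) → size w , ∈｛｝⁺ (size w) , vget-∷ʳ-new (colours w) c }
  ; distinct   = All.[] ∷ []
  ; many       = ≤-refl
  ; avoids     = λ { (here refl) x x∈Q →
                   avoid x x∈Q ∘ trans (sym (vget-∷ʳ-old (colours w) c (Admissible.Q-bounded adm x x∈Q))) }
  }

≤-trans-+ : ∀ n t u {m l} → m ≤ n + t → l ≤ m + u → l ≤ n + (t + u)
≤-trans-+ n t u {m} {l} m≤n+t l≤m+u = begin
  l             ≤⟨ l≤m+u ⟩
  m + u         ≤⟨ +-monoˡ-≤ u m≤n+t ⟩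
  n + t + u     ≡⟨ +-assoc n t u ⟩
  n + (t + u)   ∎
  where open ≤-Reasoning

module _ {w w₁ w₂ t g K Q BX RX BY RY}
         (F₁ : Forced w t g K Q w₁ BX RX) (F₂ : Forced w₁ t g (K ∪ BX) Q w₂ BY RY) where

  Forced-many-new : ∀ {h} u → h ≤ length (RX ∖ RY) →
                    Forced w (t + t + u) (g + h) K Q w₂ (BX ∪ BY) (RY ∪ˡ RX)
  Forced-many-new {h} u h≤new = record
    { extends    = ≼-trans (extends F₁) (extends F₂)
    ; rounds     = ≤-trans (≤-trans-+ (size w) t t (rounds F₁) (rounds F₂))
                           (+-monoʳ-≤ (size w) (m≤m+n (t + t) u))
    ; fresh      = λ x → [ fresh F₁ x , ≤-trans (≼-size (extends F₁)) ∘ fresh F₂ x ]′ ∘ ∪⁻ BX BY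
    ; admissible = Admissible-cong (λ x → ∨-assoc (K x) (BX x) (BY x)) (λ _ → refl) (admissible F₂)
    ; realised   = [ in-BY , in-BX ]′ ∘ ∈-∪ˡ⁻ RY RX
    ; distinct   = Unique-∪ˡ (distinct F₂) (distinct F₁)
    ; many       = subst (g + h ≤_) (sym (length-∪ˡ RY RX)) (+-mono-≤ (many F₂) h≤new)
    ; avoids     = [ avoids F₂ , avoids-≼ F₁ (extends F₂) ∘ proj₁ ∘ ∈-∖⁻ RX RY ]′ ∘ ∈-∪ˡ⁻ RY RX
    }
    where
    in-BY : ∀ {c} → c ∈ RY → ∃ λ x → x ∈ᵛ (BX ∪ BY) × colour w₂ x ≡ just c
    in-BY c∈RY with realised F₂ c∈RY
    ... | x , x∈BY , coloured = x , ∪⁺ʳ BX BY x∈BY , coloured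
    in-BX : ∀ {c} → c ∈ RX ∖ RY → ∃ λ x → x ∈ᵛ (BX ∪ BY) × colour w₂ x ≡ just c
    in-BX c∈RX∖RY with realised-≼ F₁ (extends F₂) (proj₁ (∈-∖⁻ RX RY c∈RX∖RY))
    ... | x , x∈BX , coloured = x , ∪⁺ˡ BX BY x∈BX , coloured

  -- The third stage avoids the colours of BY, and these include all but fewer
  -- than h colours of BX.
  Forced-few-new : ∀ {w₃ u b h BW RW} → Forced w₂ u b (K ∪ BX) (Q ∪ BY) w₃ BW RW →
                   length (RX ∖ RY) < h → h + h ≤ suc b →
                   Forced w (t + t + u) (g + h) K Q w₃ (BX ∪ BW) (RX ∪ˡ RW)
  Forced-few-new {w₃} {u} {b} {h} {BW} {RW} F₃ few h+h≤1+b = record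
    { extends    = w≼w₃
    ; rounds     = ≤-trans-+ (size w) (t + t) u (≤-trans-+ (size w) t t (rounds F₁) (rounds F₂)) (rounds F₃)
    ; fresh      = λ x → [ fresh F₁ x , ≤-trans (≼-size (≼-trans (extends F₁) (extends F₂))) ∘ fresh F₃ x ]′
                           ∘ ∪⁻ BX BW
    ; admissible = Admissible-cong (λ x → ∨-assoc (K x) (BX x) (BW x)) (λ _ → refl)
                     (Admissible-drop (fresh F₂) (Admissible.Q-bounded (admissible F₁)) (admissible F₃))
    ; realised   = [ in-BX , in-BW ]′ ∘ ∈-∪ˡ⁻ RX RW
    ; distinct   = Unique-∪ˡ (distinct F₁) (distinct F₃)
    ; many       = subst (g + h ≤_) (sym (length-∪ˡ RX RW)) (+-mono-≤ (many F₁) h≤new)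
    ; avoids     = [ avoids-≼ F₁ (≼-trans (extends F₂) (extends F₃))
                   , (λ c∈RW x → avoids F₃ (proj₁ (∈-∖⁻ RW RX c∈RW)) x ∘ ∪⁺ˡ Q BY) ]′ ∘ ∈-∪ˡ⁻ RX RW
    }
    where
    w≼w₃ = ≼-trans (≼-trans (extends F₁) (extends F₂)) (extends F₃)

    in-BX : ∀ {c} → c ∈ RX → ∃ λ x → x ∈ᵛ (BX ∪ BW) × colour w₃ x ≡ just c
    in-BX c∈RX with realised-≼ F₁ (≼-trans (extends F₂) (extends F₃)) c∈RX
    ... | x , x∈BX , coloured = x , ∪⁺ˡ BX BW x∈BX , coloured

    in-BW : ∀ {c} → c ∈ RW ∖ RX → ∃ λ x → x ∈ᵛ (BX ∪ BW) × colour w₃ x ≡ just c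
    in-BW c∈RW∖RX with realised F₃ (proj₁ (∈-∖⁻ RW RX c∈RW∖RX))
    ... | x , x∈BW , coloured = x , ∪⁺ʳ BX BW x∈BW , coloured

    RW∩RY=∅ : ∀ {c} → c ∈ RW → c ∉ RY
    RW∩RY=∅ c∈RW c∈RY with realised-≼ F₂ (extends F₃) c∈RY
    ... | y , y∈BY , coloured = avoids F₃ c∈RW y (∪⁺ʳ Q BY y∈BY) coloured

    RW⊆ : RW ⊆ RW ∖ RX ++ RX ∖ RY
    RW⊆ {c} c∈RW with c ∈? RX
    ... | no  c∉RX = ∈-++⁺ˡ (∈-∖⁺ c∈RW c∉RX)
    ... | yes c∈RX = ∈-++⁺ʳ (RW ∖ RX) (∈-∖⁺ c∈RX (RW∩RY=∅ c∈RW))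

    h≤new : h ≤ length (RW ∖ RX)
    h≤new = +-cancelʳ-≤ h h (length (RW ∖ RX)) (begin
      h + h                                           ≤⟨ h+h≤1+b ⟩
      suc b                                           ≤⟨ s≤s (many F₃) ⟩
      suc (length RW)                                 ≤⟨ s≤s (length-≤-⊆ (distinct F₃) RW⊆) ⟩
      suc (length (RW ∖ RX ++ RX ∖ RY))               ≡⟨ cong suc (length-++ (RW ∖ RX)) ⟩
      suc (length (RW ∖ RX) + length (RX ∖ RY))       ≡⟨ +-suc (length (RW ∖ RX)) _ ⟨
      length (RW ∖ RX) + suc (length (RX ∖ RY))       ≤⟨ +-monoʳ-≤ (length (RW ∖ RX)) few ⟩
      length (RW ∖ RX) + h                            ∎)
      where open ≤-Reasoning

-- γ L j i is the number of colours forced, and ρ L j i a bound on the number of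
-- vertices presented, by force L j i.
γ : ℕ → ℕ → ℕ → ℕ
γ L zero    i       = 1
γ L (suc j) zero    = 1
γ L (suc j) (suc i) = γ L (suc j) i + ⌈ γ L j L /2⌉

ρ : ℕ → ℕ → ℕ → ℕ
ρ L zero    i       = 1
ρ L (suc j) zero    = 1
ρ L (suc j) (suc i) = ρ L (suc j) i + ρ L (suc j) i + ρ L j L

-- What Presenter does once a stage has presented the vertices B, with colours
-- R, and the scenario has the given number of vertices.
Cont : Set
Cont = VSet → List ℕ → ℕ → Plan

leaf : VSet → VSet → ℕ → Cont → Plan
leaf K Q n κ = ask K Q (λ c → κ ｛ n ｝ (c ∷ []) (suc n))

module _ (L : ℕ) where

  force       : ℕ → ℕ → VSet → VSet → ℕ → Cont → Plan
  force₊      : ℕ → ℕ → VSet → VSet → ℕ → Cont → Plan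
  afterFirst  : ℕ → ℕ → VSet → VSet → Cont → Cont
  afterSecond : ℕ → VSet → VSet → Cont → VSet → List ℕ → Cont

  force zero    = λ _ → leaf
  force (suc j) = force₊ j

  force₊ j zero    K Q n κ = leaf K Q n κ
  force₊ j (suc i) K Q n κ = force₊ j i K Q n (afterFirst j i K Q κ)

  afterFirst j i K Q κ BX RX n₁ = force₊ j i (K ∪ BX) Q n₁ (afterSecond j K Q κ BX RX)

  afterSecond j K Q κ BX RX BY RY n₂ =
    if ⌈ γ L j L /2⌉ ≤ᵇ length (RX ∖ RY)
    then κ (BX ∪ BY) (RY ∪ˡ RX) n₂
    else force j L (K ∪ BX) (Q ∪ BY) n₂ (λ BW RW → κ (BX ∪ BW) (RX ∪ˡ RW))

⌈n/2⌉+⌈n/2⌉≤1+n : ∀ n → ⌈ n /2⌉ + ⌈ n /2⌉ ≤ suc n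
⌈n/2⌉+⌈n/2⌉≤1+n n = ≤-trans (+-monoʳ-≤ ⌈ n /2⌉ (⌊n/2⌋≤⌈n/2⌉ (suc n))) (≤-reflexive (⌊n/2⌋+⌈n/2⌉≡n (suc n)))

module _ {k r N : ℕ} where

  Continues : State → ℕ → ℕ → VSet → VSet → Cont → Set
  Continues w t g K Q κ = ∀ w′ B R → Forced w t g K Q w′ B R → Winning k r N w′ (κ B R (size w′))

  leaf-wins : ∀ {w K Q κ} → Admissible (pres w) K Q → NoCliqueIn (pres w) Q k → size w < r →
              Continues w 1 1 K Q κ → Winning k r N w (leaf K Q (size w) κ)
  leaf-wins adm noQ w<r cont = ask adm noQ w<r λ c avoid → cont _ _ _ (Forced-leaf adm c avoid)

  force-wins  : ∀ L j i {K Q w q κ} → Admissible (pres w) K Q → NoCliqueIn (pres w) Q q → j + q ≤ k →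
                size w + ρ L j i ≤ r → Continues w (ρ L j i) (γ L j i) K Q κ →
                Winning k r N w (force L j i K Q (size w) κ)
  force₊-wins : ∀ L j i {K Q w q κ} → Admissible (pres w) K Q → NoCliqueIn (pres w) Q q → suc j + q ≤ k →
                size w + ρ L (suc j) i ≤ r → Continues w (ρ L (suc j) i) (γ L (suc j) i) K Q κ →
                Winning k r N w (force₊ L j i K Q (size w) κ)

  force-wins L zero    i adm noQ q≤k budget cont =
    leaf-wins adm (noQ ∘ CliqueIn-shrink q≤k) (≤-trans (≤-reflexive (+-comm 1 _)) budget) cont
  force-wins L (suc j) i = force₊-wins L j i

  force₊-wins L j zero    adm noQ j+q≤k budget cont =
    leaf-wins adm (noQ ∘ CliqueIn-shrink (m+n≤o⇒n≤o (suc j) j+q≤k))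
      (≤-trans (≤-reflexive (+-comm 1 _)) budget) cont
  force₊-wins L j (suc i) {K} {Q} {w} {q} {κ} adm noQ j+q≤k budget cont =
    force₊-wins L j i adm noQ j+q≤k
      (spend {w} 0 ρ₁ (≤-reflexive (sym (+-identityʳ (size w)))) (≤-trans (m≤m+n ρ₁ ρ₁) (m≤m+n _ ρ₀))) first
    where
    ρ₁ = ρ L (suc j) i
    ρ₀ = ρ L j L
    g  = γ L (suc j) i
    h  = ⌈ γ L j L /2⌉

    spend : ∀ {w′} t u → size w′ ≤ size w + t → t + u ≤ ρ₁ + ρ₁ + ρ₀ → size w′ + u ≤ r
    spend t u w′≤w+t t+u≤ρ =
      ≤-trans (≤-trans-+ (size w) t u w′≤w+t ≤-refl) (≤-trans (+-monoʳ-≤ (size w) t+u≤ρ) budget)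

    second : ∀ {w₁ BX RX} → Forced w ρ₁ g K Q w₁ BX RX →
             Continues w₁ ρ₁ g (K ∪ BX) Q (afterSecond L j K Q κ BX RX)
    second {w₁} {BX} {RX} F₁ w₂ BY RY F₂
      with h ≤ᵇ length (RX ∖ RY) | ≤ᵇ-reflects-≤ h (length (RX ∖ RY))
    ... | true  | ofʸ many-new = cont w₂ _ _ (Forced-many-new F₁ F₂ ρ₀ many-new)
    ... | false | ofⁿ few-new  =
      force-wins L j L adm₂ noQ₂ (≤-trans (≤-reflexive (+-suc j q)) j+q≤k)
        (spend {w₂} (ρ₁ + ρ₁) ρ₀ (≤-trans-+ (size w) ρ₁ ρ₁ (rounds F₁) (rounds F₂)) ≤-refl)
        (λ w₃ BW RW F₃ → cont w₃ _ _
          (Forced-few-new F₁ F₂ F₃ (≰⇒> few-new) (⌈n/2⌉+⌈n/2⌉≤1+n (γ L j L))))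
      where
      adm₂ = Admissible-move (fresh F₂) (Admissible.K-bounded (admissible F₁)) (admissible F₂)
      BY-independent : ∀ x y → x ∈ᵛ BY → y ∈ᵛ BY → ¬ Edge (pres w₂) x y
      BY-independent x y x∈BY y∈BY =
        Admissible-K-independent (admissible F₂) x y (∪⁺ʳ (K ∪ BX) BY x∈BY) (∪⁺ʳ (K ∪ BX) BY y∈BY)
      noQ₂ : NoCliqueIn (pres w₂) (Q ∪ BY) (suc q)
      noQ₂ = noQ ∘ CliqueIn-≼⁻ (≼-trans (extends F₁) (extends F₂)) (Admissible.Q-bounded adm)
                 ∘ CliqueIn-∪-independent BY-independent

    first : Continues w ρ₁ g K Q (afterFirst L j i K Q κ)
    first w₁ BX RX F₁ =
      force₊-wins L j i (admissible F₁) (noQ ∘ CliqueIn-≼⁻ (extends F₁) (Admissible.Q-bounded adm)) j+q≤k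
        (spend {w₁} ρ₁ ρ₁ (rounds F₁) (m≤m+n _ ρ₀))
        (second F₁)

-- Bounds on colours and vertices

ρ-positive : ∀ L j i → 1 ≤ ρ L j i
ρ-positive L zero    i       = ≤-refl
ρ-positive L (suc j) zero    = ≤-refl
ρ-positive L (suc j) (suc i) = ≤-trans (ρ-positive L (suc j) i) (≤-trans (m≤m+n _ _) (m≤m+n _ _))

ρ-+ : ∀ L j i → ρ L (suc j) i + ρ L j L ≡ 2 ^ i * suc (ρ L j L)
ρ-+ L j zero    = sym (+-identityʳ (suc (ρ L j L)))
ρ-+ L j (suc i) = begin
  ρ₁ + ρ₁ + ρ₀ + ρ₀               ≡⟨ regroup ⟩
  2 * (ρ₁ + ρ₀)                   ≡⟨ cong (2 *_) (ρ-+ L j i) ⟩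
  2 * (2 ^ i * suc ρ₀)            ≡⟨ *-assoc 2 (2 ^ i) (suc ρ₀) ⟨
  2 ^ suc i * suc ρ₀              ∎
  where
  open ≡-Reasoning
  ρ₁ = ρ L (suc j) i
  ρ₀ = ρ L j L
  regroup : ρ₁ + ρ₁ + ρ₀ + ρ₀ ≡ 2 * (ρ₁ + ρ₀)
  regroup = solve 2 (λ a b → a :+ a :+ b :+ b := (a :+ b) :+ ((a :+ b) :+ con 0)) refl ρ₁ ρ₀

ρ-bound : ∀ L j → ρ L j L ≤ 2 ^ (suc L * j)
ρ-bound L zero    = ≤-reflexive (cong (2 ^_) (sym (*-zeroʳ (suc L))))
ρ-bound L (suc j) = begin
  ρ L (suc j) L                  ≤⟨ m≤m+n _ ρ₀ ⟩
  ρ L (suc j) L + ρ₀             ≡⟨ ρ-+ L j L ⟩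
  2 ^ L * suc ρ₀                 ≤⟨ *-monoʳ-≤ (2 ^ L) (+-monoˡ-≤ ρ₀ (ρ-positive L j L)) ⟩
  2 ^ L * (ρ₀ + ρ₀)              ≡⟨ solve 2 (λ a b → a :* (b :+ b) := (con 2 :* a) :* b) refl (2 ^ L) ρ₀ ⟩
  2 ^ suc L * ρ₀                 ≤⟨ *-monoʳ-≤ (2 ^ suc L) (ρ-bound L j) ⟩
  2 ^ suc L * 2 ^ (suc L * j)    ≡⟨ ^-distribˡ-+-* 2 (suc L) (suc L * j) ⟨
  2 ^ (suc L + suc L * j)        ≡⟨ cong (2 ^_) (*-suc (suc L) j) ⟨
  2 ^ (suc L * suc j)            ∎
  where
  open ≤-Reasoning
  ρ₀ = ρ L j L

γ-linear : ∀ L j i → i * ⌈ γ L j L /2⌉ ≤ γ L (suc j) i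
γ-linear L j zero    = z≤n
γ-linear L j (suc i) =
  ≤-trans (≤-reflexive (+-comm ⌈ γ L j L /2⌉ _)) (+-monoˡ-≤ ⌈ γ L j L /2⌉ (γ-linear L j i))

n≤⌈n/2⌉+⌈n/2⌉ : ∀ n → n ≤ ⌈ n /2⌉ + ⌈ n /2⌉
n≤⌈n/2⌉+⌈n/2⌉ n = ≤-trans (≤-reflexive (sym (⌊n/2⌋+⌈n/2⌉≡n n))) (+-monoˡ-≤ ⌈ n /2⌉ (⌊n/2⌋≤⌈n/2⌉ n))

γ-bound : ∀ L j → L ^ j ≤ 2 ^ j * γ L j L
γ-bound L zero    = ≤-refl
γ-bound L (suc j) = begin
  L * L ^ j                        ≤⟨ *-monoʳ-≤ L (γ-bound L j) ⟩
  L * (2 ^ j * b)                  ≡⟨ solve 3 (λ l p b → l :* (p :* b) := p :* (l :* b)) refl L (2 ^ j) b ⟩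
  2 ^ j * (L * b)                  ≤⟨ *-monoʳ-≤ (2 ^ j) (*-monoʳ-≤ L (n≤⌈n/2⌉+⌈n/2⌉ b)) ⟩
  2 ^ j * (L * (h + h))            ≡⟨ regroup ⟩
  2 ^ j * 2 * (L * h)              ≤⟨ *-monoʳ-≤ (2 ^ j * 2) (γ-linear L j L) ⟩
  2 ^ j * 2 * γ L (suc j) L        ≡⟨ cong (_* γ L (suc j) L) (*-comm (2 ^ j) 2) ⟩
  2 ^ suc j * γ L (suc j) L        ∎
  where
  open ≤-Reasoning
  b = γ L j L
  h = ⌈ b /2⌉
  regroup : 2 ^ j * (L * (h + h)) ≡ 2 ^ j * 2 * (L * h)
  regroup = solve 3 (λ p l h → p :* (l :* (h :+ h)) := (p :* con 2) :* (l :* h)) refl (2 ^ j) L h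

^-distribʳ-* : ∀ m n o → (m * n) ^ o ≡ m ^ o * n ^ o
^-distribʳ-* m n zero    = refl
^-distribʳ-* m n (suc o) = begin
  m * n * (m * n) ^ o          ≡⟨ cong (m * n *_) (^-distribʳ-* m n o) ⟩
  m * n * (m ^ o * n ^ o)      ≡⟨ swap ⟩
  m * m ^ o * (n * n ^ o)      ∎
  where
  open ≡-Reasoning
  swap : m * n * (m ^ o * n ^ o) ≡ m * m ^ o * (n * n ^ o)
  swap = solve 4 (λ m n p q → m :* n :* (p :* q) := m :* p :* (n :* q)) refl m n (m ^ o) (n ^ o)

n<2^n : ∀ n → n < 2 ^ n
n<2^n zero    = s≤s z≤n
n<2^n (suc n) = +-mono-≤ (m^n>0 2 n) (≤-trans (n<2^n n) (≤-reflexive (sym (+-identityʳ (2 ^ n)))))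

2*m^j∸1≤[2*m]^j : ∀ j m → 2 * m ^ j ∸ 1 ≤ (2 * m) ^ j
2*m^j∸1≤[2*m]^j zero    m = ≤-refl
2*m^j∸1≤[2*m]^j (suc j) m = begin
  2 * (m * m ^ j) ∸ 1     ≤⟨ m∸n≤m _ 1 ⟩
  2 * (m * m ^ j)         ≡⟨ *-assoc 2 m (m ^ j) ⟨
  2 * m * m ^ j           ≤⟨ *-monoʳ-≤ (2 * m) (^-monoˡ-≤ j (m≤m+n m _)) ⟩
  2 * m * (2 * m) ^ j     ∎
  where open ≤-Reasoning

colours-bound : ∀ j m → 2 * m ^ j ∸ 1 ≤ γ (4 * m) j (4 * m)
colours-bound j m = ≤-trans (2*m^j∸1≤[2*m]^j j m) (*-cancelˡ-≤ (2 ^ j) {{m^n≢0 2 j}} (begin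
  2 ^ j * (2 * m) ^ j          ≡⟨ ^-distribʳ-* 2 (2 * m) j ⟨
  (2 * (2 * m)) ^ j            ≡⟨ cong (_^ j) (*-assoc 2 2 m) ⟨
  (4 * m) ^ j                  ≤⟨ γ-bound (4 * m) j ⟩
  2 ^ j * γ (4 * m) j (4 * m)  ∎))
  where open ≤-Reasoning

scenariosUpTo-bound : ∀ {r} E → r ≤ 2 ^ E → length (scenariosUpTo r) ≤ 2 ^ (2 ^ (2 + (E + E)))
scenariosUpTo-bound {r} E r≤X = begin
  length (scenariosUpTo r)        ≤⟨ length-scenariosUpTo r ⟩
  suc r * 4 ^ (r * r)             ≤⟨ *-monoˡ-≤ (4 ^ (r * r)) (≤-trans (n<2^n r) (^-monoˡ-≤ r (m≤m+n 2 2))) ⟩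
  4 ^ r * 4 ^ (r * r)             ≡⟨ ^-distribˡ-+-* 4 r (r * r) ⟨
  4 ^ (r + r * r)                 ≡⟨ ^-*-assoc 2 2 (r + r * r) ⟩
  2 ^ (2 * (r + r * r))           ≤⟨ ^-monoʳ-≤ 2 (*-monoʳ-≤ 2 (+-mono-≤ r≤XX (*-mono-≤ r≤X r≤X))) ⟩
  2 ^ (2 * (X * X + X * X))       ≡⟨ cong (2 ^_) (solve 1 (λ x → con 2 :* (x :* x :+ x :* x) := con 4 :* (x :* x))
                                                      refl X) ⟩
  2 ^ (4 * (X * X))               ≡⟨ cong (λ e → 2 ^ (4 * e)) (^-distribˡ-+-* 2 E E) ⟨
  2 ^ (2 ^ 2 * 2 ^ (E + E))       ≡⟨ cong (2 ^_) (^-distribˡ-+-* 2 2 (E + E)) ⟨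
  2 ^ (2 ^ (2 + (E + E)))         ∎
  where
  open ≤-Reasoning
  X = 2 ^ E
  r≤XX : r ≤ X * X
  r≤XX = ≤-trans r≤X (≤-trans (≤-reflexive (sym (*-identityʳ X))) (*-monoʳ-≤ X (m^n>0 2 E)))

exponent-bound : ∀ j a → 2 + (suc (4 * suc a) * j + suc (4 * suc a) * j) ≤ 12 * suc j * suc a
exponent-bound j a = subst (2 + (E + E) ≤_) (sym expand) (m≤m+n _ slack)
  where
  E = suc (4 * suc a) * j
  slack = 4 * a * j + 2 * j + 12 * a + 10
  expand : 12 * suc j * suc a ≡ 2 + (E + E) + slack
  expand = solve 2 (λ a j → con 12 :* (con 1 :+ j) :* (con 1 :+ a) :=
                     con 2 :+ ((con 1 :+ con 4 :* (con 1 :+ a)) :* j :+ (con 1 :+ con 4 :* (con 1 :+ a)) :* j)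
                       :+ (con 4 :* a :* j :+ con 2 :* j :+ con 12 :* a :+ con 10)) refl a j

ABS-forces : ∀ j a → Σ Strategy λ S →
  Forces (suc j) S (2 * suc a ^ j ∸ 1) (2 ^ (12 * suc j * suc a)) (2 ^ (2 ^ (12 * suc j * suc a)))
ABS-forces j a = planStrategy P , Winning-Forces P (s≤s z≤n) winning r≤R scenarios≤B
  where
  m = suc a
  L = 4 * m
  E = suc L * j
  P : Plan
  P = force L j L ∅ ∅ 0 (λ _ _ _ → stop)

  finish : Continues {suc j} {ρ L j L} {2 * m ^ j ∸ 1} (0 , [] , []) (ρ L j L) (γ L j L) ∅ ∅ (λ _ _ _ → stop)
  finish w′ B R F =
    stop (rounds F) (UsesAtLeast-from w′ R (distinct F) (≤-trans (colours-bound j m) (many F)) vertices)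
    where
    vertices : ∀ {c} → c ∈ R → ∃ λ x → x < size w′ × colour w′ x ≡ just c
    vertices c∈R with realised F c∈R
    ... | x , x∈B , coloured = x , B-bounded F x x∈B , coloured

  winning : Winning (suc j) (ρ L j L) (2 * m ^ j ∸ 1) (0 , [] , []) P
  winning = force-wins L j L Admissible-∅ NoCliqueIn-∅ (≤-reflexive (+-comm j 1)) ≤-refl finish

  r≤R : ρ L j L ≤ 2 ^ (12 * suc j * m)
  r≤R = ≤-trans (ρ-bound L j)
          (^-monoʳ-≤ 2 (≤-trans (≤-trans (m≤m+n E E) (m≤n+m (E + E) 2)) (exponent-bound j a)))

  scenarios≤B : length (scenariosUpTo (ρ L j L)) ≤ 2 ^ (2 ^ (12 * suc j * m))
  scenarios≤B = ≤-trans (scenariosUpTo-bound E (ρ-bound L j)) (^-monoʳ-≤ 2 (^-monoʳ-≤ 2 (exponent-bound j a)))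

lemma8p1 : Σ (ℕ → ℕ) λ g → ∀ k m → 1 ≤ k → 1 ≤ m →
    Σ Strategy λ S →
      Forces k S (2 * m ^ (k ∸ 1) ∸ 1) (2 ^ (g k * m)) (2 ^ (2 ^ (g k * m)))
lemma8p1 = (λ k → 12 * k) , λ where
  (suc j) (suc a) _ _ → ABS-forces j a
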